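{- Let $t\in V(G)\setminus\{s\}$ and $\pi\in\Pi(s,t;G_{i-1}^t)$. Then the subpath $\pi[q(\pi):t]$ is entirely contained in $H_{i-1}^t$.
   Context: Let $G$ be a directed graph with vertex set $V(G)$ and edge set $E(G)$, with non-negative edge costs $c$; $G$ is anti-symmetric (if $(u,v)\in E(G)$ then $(v,u)\notin E(G)$). The cost $c(\pi)$ of a path is the sum of its edge costs. Fix a source $s$ and an integer $p\ge1$ such that $G$ is $p$-edge-outconnected from $s$ (for every $t\ne s$ there are $p$ pairwise edge-disjoint $s$–$t$ paths in $G$). Fix $2\le i\le p$ and a spanning subgraph $H_{i-1}$ of $G$. For every $t\neq s$ let $S_{i-1}^t\subseteq E(H_{i-1})$ be the edge set of $i-1$ pairwise edge-disjoint $s$–$t$ paths of minimum total cost among all such families in $G$. The residual network $G_{i-1}^t$ is obtained from $G$ by replacing each $(u,v)\in S_{i-1}^t$ by $(v,u)$ with cost $-c(u,v)$; the graph $H_{i-1}^t$ is obtained from $H_{i-1}$ by replacing each $(u,v)\in S_{i-1}^t$ by $(v,u)$ with cost $-c(u,v)$ and adding all edges of $E(G)\setminus S_{i-1}^t$ incident to $t$. A path is entirely contained in a graph if all its edges, with orientation, are edges of it. For a path $\pi$, $\eta(\pi)$ is the number of edges of $\pi$ in $E(G)\setminus E(H_{i-1})$ (original orientation), $|\pi|=(c(\pi),\eta(\pi))$, compared lexicographically; $\Pi(s,t;G_{i-1}^t)$ is the set of $s$–$t$ paths in $G_{i-1}^t$ minimal in this order. $\pi[u:v]$ is the subpath of $\pi$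 from $u$ to $v$. $q(\pi)$ is the last internal vertex of $\pi$ whose incoming edge in $\pi$ belongs to $E(G)\setminus E(H_{i-1})$, and $q(\pi)=s$ if there is none. -}

module Defs where

open import Data.Nat using (ℕ; zero; suc; _≤_; _<_)
open import Data.Integer as ℤ using (ℤ; +_; -_)
open import Data.Fin using (Fin)
open import Data.Bool using (Bool; true; false; T; _∧_; _∨_; not; if_then_else_)
open import Data.List using (List; []; _∷_; map; allFin; head; last; length)
open import Data.List.Relation.Unary.All using (All)
open import Data.List.Relation.Unary.Unique.Propositional using (Unique)
open import Data.List.Membership.Propositional using (_∈_)
open import Data.Maybe using (Maybe; just)
open import Data.Product using (_×_; _,_; Σ; ∃; ∃-syntax)
open import Data.Sum using (_⊎_)
open import Relation.Binary.PropositionalEquality using (_≡_; _≢_)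
open import Relation.Nullary using (¬_)
open import Function.Bundles using (_⇔_)
open import Relation.Nullary.Decidable using (⌊_⌋)
open import Data.Fin using (_≟_)

-- An edge set is a Boolean relation  E u v = true  iff (u,v) is a (directed) edge.
-- (Since G is anti-symmetric, an edge is determined by its ordered endpoints,
--  also in residual networks.)
EdgeSet : ℕ → Set
EdgeSet n = Fin n → Fin n → Bool

Cost : ℕ → Set
Cost n = Fin n → Fin n → ℕ

module _ {n : ℕ} where

  V : Set
  V = Fin n

  edgesOf : List V → List (V × V)
  edgesOf (x ∷ y ∷ r) = (x , y) ∷ edgesOf (y ∷ r)
  edgesOf _ = []

  IsPath : EdgeSet n → V → V → List V → Set
  IsPath E s t π =
    head π ≡ just s × last π ≡ just t ×
    All (λ e → T (E (Data.Product.proj₁ e) (Data.Product.proj₂ e))) (edgesOf π) ×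
    Unique π

  AntiSymmetric : EdgeSet n → Set
  AntiSymmetric E = ∀ u v → T (E u v) → ¬ T (E v u)

  SubgraphOf : EdgeSet n → EdgeSet n → Set
  SubgraphOf H G = ∀ u v → T (H u v) → T (G u v)

  EdgeDisjoint : List V → List V → Set
  EdgeDisjoint π π' = ∀ e → e ∈ edgesOf π → ¬ (e ∈ edgesOf π')

  DisjointPaths : EdgeSet n → V → V → (k : ℕ) → (Fin k → List V) → Set
  DisjointPaths G s t k F =
    (∀ j → IsPath G s t (F j)) × (∀ j j' → j ≢ j' → EdgeDisjoint (F j) (F j'))

  OutConnected : EdgeSet n → V → ℕ → Set
  OutConnected G s p = ∀ t → t ≢ s → ∃[ F ] DisjointPaths G s t p F

  sumℕ : List ℕ → ℕ
  sumℕ [] = 0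
  sumℕ (x ∷ xs) = x Data.Nat.+ sumℕ xs

  sumℤ : List ℤ → ℤ
  sumℤ [] = + 0
  sumℤ (x ∷ xs) = x ℤ.+ sumℤ xs

  pathCost : Cost n → List V → ℕ
  pathCost c π = sumℕ (map (λ e → c (Data.Product.proj₁ e) (Data.Product.proj₂ e)) (edgesOf π))

  familyCost : Cost n → (k : ℕ) → (Fin k → List V) → ℕ
  familyCost c k F = sumℕ (map (λ j → pathCost c (F j)) (allFin k))

  MinCostDisjointPathsEdgeSet : EdgeSet n → Cost n → V → V → ℕ → EdgeSet n → Set
  MinCostDisjointPathsEdgeSet G c s t k S =
    Σ (Fin k → List V) λ F →
      DisjointPaths G s t k F ×
      (∀ u v → T (S u v) ⇔ (∃[ j ] (u , v) ∈ edgesOf (F j))) ×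
      (∀ F' → DisjointPaths G s t k F' → familyCost c k F Data.Nat.≤ familyCost c k F')

  residualEdges : EdgeSet n → EdgeSet n → EdgeSet n
  residualEdges G S u v = (G u v ∧ not (S u v)) ∨ S v u

  residualCost : Cost n → EdgeSet n → Fin n → Fin n → ℤ
  residualCost c S u v = if S v u then - (+ c v u) else + c u v

  isEq : V → V → Bool
  isEq u v = ⌊ u ≟ v ⌋

  HtEdges : EdgeSet n → EdgeSet n → EdgeSet n → V → EdgeSet n
  HtEdges G H S t u v =
    (H u v ∧ not (S u v)) ∨ S v u ∨ (G u v ∧ not (S u v) ∧ (isEq u t ∨ isEq v t))

  resPathCost : Cost n → EdgeSet n → List V → ℤ
  resPathCost c S π =
    sumℤ (map (λ e → residualCost c S (Data.Product.proj₁ e) (Data.Product.proj₂ e)) (edgesOf π))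

  isNew : EdgeSet n → EdgeSet n → V → V → Bool
  isNew G H u v = G u v ∧ not (H u v)

  eta : EdgeSet n → EdgeSet n → List V → ℕ
  eta G H π = length (Data.List.filter (λ e → T? (isNew G H (Data.Product.proj₁ e) (Data.Product.proj₂ e))) (edgesOf π))
    where open import Data.Bool.Properties using (T?)

  _≤lex_ : ℤ × ℕ → ℤ × ℕ → Set
  (a , x) ≤lex (b , y) = (a ℤ.< b) ⊎ (a ≡ b × x ≤ y)

  InPi : EdgeSet n → EdgeSet n → Cost n → EdgeSet n → V → V → List V → Set
  InPi G H c S s t π =
    IsPath (residualEdges G S) s t π ×
    (∀ π' → IsPath (residualEdges G S) s t π' →
       (resPathCost c S π , eta G H π) ≤lex (resPathCost c S π' , eta G H π'))

  -- π[q(π):t]: scanning π = v0 v1 ... vk, the candidate suffix is replaced by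
  -- (vj ... vk) whenever vj is internal (j < k) and its incoming edge
  -- (v_{j-1}, vj) lies in E(G)∖E(H).  Initially the candidate is all of π
  -- (q(π) = s = v0 if there is no such vertex).
  scanQ : EdgeSet n → EdgeSet n → List V → V → List V → List V
  scanQ G H cand prev [] = cand
  scanQ G H cand prev (v ∷ []) = cand
  scanQ G H cand prev (v ∷ w ∷ r) =
    if isNew G H prev v then scanQ G H (v ∷ w ∷ r) v (w ∷ r)
                        else scanQ G H cand v (w ∷ r)

  qSuffix : EdgeSet n → EdgeSet n → List V → List V
  qSuffix G H [] = []
  qSuffix G H (x ∷ r) = scanQ G H (x ∷ r) x r

  ContainedIn : List V → EdgeSet n → Set
  ContainedIn π E = All (λ e → T (E (Data.Product.proj₁ e) (Data.Product.proj₂ e))) (edgesOf π)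

{-# OPTIONS --safe #-}
module Submission where

-- After q(π) no edge of π is new, i.e. none lies in
-- G ∖ H, except possibly the final edge into t.  A residual edge that is not
-- new is a reversed S-edge or an edge of H ∖ S, and an edge of G ∖ S into t
-- was added to H^t explicitly; either way it lies in H^t.

open import Defs
open import Data.Nat using (ℕ; _≤_)
open import Data.Fin using (Fin; _≟_)
open import Data.Bool using (true; false; T; _∧_; _∨_; not)
open import Data.Bool.Properties using (T-∨; ∨-zeroʳ; ∧-identityʳ)
open import Data.List using (List; []; _∷_; last)
open import Data.List.Relation.Unary.All using ([]; _∷_)
open import Data.Maybe using (just)
open import Data.Product using (_,_)
open import Data.Sum using (inj₁; inj₂)
open import Function using (id; _∘_)
open import Function.Bundles using (Equivalence)
open import Relation.Binary.PropositionalEquality using (_≡_; _≢_; refl; trans)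
open import Relation.Nullary.Decidable using (isYes≗does; dec-true)

∨-introˡ : ∀ {a} b → T a → T (a ∨ b)
∨-introˡ _ = Equivalence.from T-∨ ∘ inj₁

∨-introʳ : ∀ a {b} → T b → T (a ∨ b)
∨-introʳ _ = Equivalence.from T-∨ ∘ inj₂

isEq-refl : ∀ {n} (v : Fin n) → isEq v v ≡ true
isEq-refl v = trans (isYes≗does (v ≟ v)) (dec-true (v ≟ v) refl)

module _ {n : ℕ} (G H : EdgeSet n) where

  module _ {E F : EdgeSet n} {t : Fin n}
           (notNew⇒F : ∀ {u v} → T (E u v) → isNew G H u v ≡ false → T (F u v))
           (intoT⇒F : ∀ {u} → T (E u t) → T (F u t)) where

    -- cand is the current candidate for π[q(π):t], and the invariant is that
    -- it lies in F as soon as the unscanned rest prev ∷ l does.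
    scanQ-contained : ∀ cand prev l →
      ContainedIn (prev ∷ l) E → last (prev ∷ l) ≡ just t →
      (ContainedIn (prev ∷ l) F → ContainedIn cand F) →
      ContainedIn (scanQ G H cand prev l) F
    scanQ-contained cand prev []          _        _    inv = inv []
    scanQ-contained cand prev (v ∷ [])    (e ∷ []) refl inv = inv (intoT⇒F e ∷ [])
    scanQ-contained cand prev (v ∷ w ∷ l) (e ∷ es) ends inv with isNew G H prev v in new
    ... | true  = scanQ-contained (v ∷ w ∷ l) v (w ∷ l) es ends id
    ... | false = scanQ-contained cand v (w ∷ l) es ends (inv ∘ (notNew⇒F e new ∷_))

    qSuffix-contained : ∀ π → ContainedIn π E → last π ≡ just t →
      ContainedIn (qSuffix G H π) F
    qSuffix-contained []      _  _    = []
    qSuffix-contained (x ∷ π) es ends = scanQ-contained (x ∷ π) x π es ends id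

  module _ (S : EdgeSet n) (t : Fin n) where

    notNew-residual⇒Ht : ∀ {u v} → T (residualEdges G S u v) → isNew G H u v ≡ false →
      T (HtEdges G H S t u v)
    notNew-residual⇒Ht {u} {v} = helper (G u v) (H u v) (S u v) (S v u) _
      where
      helper : ∀ g h s s′ x → T ((g ∧ not s) ∨ s′) → g ∧ not h ≡ false →
        T ((h ∧ not s) ∨ s′ ∨ x)
      helper g     h     s     true  x _  _  = ∨-introʳ (h ∧ not s) _
      helper true  true  false false x _  _  = _
      helper true  false false false x _  ()
      helper true  h     true  false x () _
      helper false h     s     false x () _

    residual-into-t⇒Ht : ∀ {u} → T (residualEdges G S u t) → T (HtEdges G H S t u t)
    residual-into-t⇒Ht {u} r
      rewrite isEq-refl t | ∨-zeroʳ (isEq u t) | ∧-identityʳ (not (S u t))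
      = helper (G u t ∧ not (S u t)) (S t u) (H u t ∧ not (S u t)) r
      where
      helper : ∀ a b c → T (a ∨ b) → T (c ∨ b ∨ a)
      helper true  b c _  = ∨-introʳ c (∨-introʳ b _)
      helper false b c tb = ∨-introʳ c (∨-introˡ false tb)

lemma11 : (n : ℕ) (G : EdgeSet n) (c : Cost n) (s : Fin n) (p : ℕ) →
    AntiSymmetric G → OutConnected G s p →
    (i : ℕ) → 2 ≤ i → i ≤ p →
    (H : EdgeSet n) → SubgraphOf H G →
    (S : Fin n → EdgeSet n) →
    (∀ t → t ≢ s → MinCostDisjointPathsEdgeSet G c s t (i Data.Nat.∸ 1) (S t)) →
    (∀ t → t ≢ s → SubgraphOf (S t) H) →
    (t : Fin n) → t ≢ s →
    (π : List (Fin n)) → InPi G H c (S t) s t π →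
    ContainedIn (qSuffix G H π) (HtEdges G H (S t) t)
lemma11 n G c s p _ _ i _ _ H _ S _ _ t _ π ((_ , ends , inResidual , _) , _) =
  qSuffix-contained G H (notNew-residual⇒Ht G H (S t) t) (residual-into-t⇒Ht G H (S t) t)
    π inResidual ends
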